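{- For every integer $n\geq 0$, the number of set partitions $\Pi$ of $[n+1]$ such that $\mathrm{Flatten}(\Pi)$ avoids the pattern $321$ equals $\sum_{k=0}^{n}\binom{n}{k}C_k$, where $C_k=\frac{1}{k+1}\binom{2k}{k}$ is the $k$-th Catalan number.
   Context: A set partition $\Pi$ of $[m]=\{1,\dots,m\}$ is written in standard increasing form: the entries within each block are listed in increasing order, and the blocks are listed in increasing order of their smallest (first) entries. $\mathrm{Flatten}(\Pi)$ is the permutation of $[m]$ (in one-line notation) obtained by concatenating the blocks of $\Pi$ written in this standard increasing form; e.g. $\Pi = 136\text{ - }279\text{ - }4\text{ - }58$ gives $\mathrm{Flatten}(\Pi)=136279458$. A permutation $p=p_1\cdots p_m$ avoids a pattern $\pi=\pi_1\cdots\pi_r$ (a permutation of $[r]$) if there are no indices $i_1<\dots<i_r$ such that $p_{i_1},\dots,p_{i_r}$ are in the same relative order as $\pi_1,\dots,\pi_r$. -}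

module Defs where

open import Data.Nat using (ℕ; zero; suc; _<_; _+_; _*_; _/_)
open import Data.Nat.Combinatorics using (_C_)
open import Data.Fin using (Fin) renaming (_<_ to _<ᶠ_)
open import Data.List using (List; []; _∷_; concat; length; lookup; map; upTo)
open import Data.Nat.ListAction using (sum)
open import Data.List.Relation.Unary.All using (All)
open import Data.List.Relation.Unary.Linked using (Linked)
open import Data.List.Relation.Binary.Permutation.Propositional using (_↭_)
open import Data.Product using (_×_)
open import Data.Empty using (⊥)
open import Data.Unit using (⊤)
open import Relation.Nullary using (¬_)

range : ℕ → List ℕ
range m = map suc (upTo m)

NonEmptyBlock : List ℕ → Set
NonEmptyBlock []      = ⊥
NonEmptyBlock (_ ∷ _) = ⊤

FirstLt : List ℕ → List ℕ → Set
FirstLt (x ∷ _) (y ∷ _) = x < y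
FirstLt _       _       = ⊥

-- Π (list of blocks) is a set partition of [m] written in standard increasing form:
-- every block is nonempty and increasing, blocks are ordered by their first
-- entries, and the blocks together contain each element of [m] exactly once.
IsStdPartition : ℕ → List (List ℕ) → Set
IsStdPartition m Π =
  All NonEmptyBlock Π × All (Linked _<_) Π × Linked FirstLt Π × (concat Π ↭ range m)

Flatten : List (List ℕ) → List ℕ
Flatten = concat

Avoids321 : List ℕ → Set
Avoids321 p = (i j k : Fin (length p)) → i <ᶠ j → j <ᶠ k →
  ¬ (lookup p j < lookup p i × lookup p k < lookup p j)

catalan : ℕ → ℕ
catalan k = ((2 * k) C k) / suc k

binomCatalanSum : ℕ → ℕ
binomCatalanSum n = sum (map (λ k → (n C k) * catalan k) (upTo (suc n)))

module Submission where

-- A 321-avoiding standard partition of [k + 1] arises uniquely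
-- from one of [k] by inserting the maximum k + 1 either at the end of a block
-- whose following blocks flatten to an increasing list, or as a new last
-- singleton block ('Extends', 'insertions').  Label a partition by its number L of blocks that the next
-- maximum may be appended to ('activeBlocks').  Its children carry the labels
-- L, L - 1, …, 2, L, L + 1 ('flattenRule', via the invariant 'profiles'): the
-- Catalan generating tree (L) ↦ (2) … (L + 1) with one extra child of label L.
-- Such a self-loop turns level counts into their binomial transform
-- ('selfLoop'), and the Catalan tree has C_d nodes at depth d by the ballot
-- theorem ('catalan≡leaves').

open import Defs
open import Data.Nat using (ℕ; zero; suc; _+_; _*_; _∸_; _/_; _<_; _≤_; _<?_; s≤s; s≤s⁻¹; z≤n)
open import Data.Nat.Properties
  using ( +-identityʳ; +-assoc; +-comm; +-suc; +-cancelʳ-≡; *-comm; *-zeroʳ; *-identityʳ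
        ; *-distribˡ-+; *-distribʳ-+; +-commutativeSemigroup; m≤m+n; m≤n+m; m+n∸m≡n; n<1+n
        ; ≤-trans; <-asym; <-trans; <-cmp; <-irrefl; <⇒≱; ≤∧≢⇒<; suc-injective)
open import Data.Nat.Combinatorics using (_C_; nCk+nC[k+1]≡[n+1]C[k+1]; k>n⇒nCk≡0; nCk≡nC[n∸k]; nC1≡n)
open import Data.Nat.DivMod using (m*n/n≡m)
open import Data.Nat.ListAction using (sum)
open import Data.Nat.ListAction.Properties using (sum-↭; sum-++)
open import Data.Nat.Tactic.RingSolver using (solve-∀)
open import Data.Bool using (Bool; true; false; _∧_)
open import Data.Bool.Properties using (∧-zeroʳ; ∧-identityʳ)
open import Data.Fin using (Fin; zero; suc) renaming (_<_ to _<ᶠ_)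
open import Data.List using (List; []; _∷_; _++_; length; lookup; concat; map; concatMap; upTo; applyUpTo)
open import Data.List.Properties
  using (++-assoc; ++-identityʳ; ++-cancelʳ; ++-conicalʳ; ∷-injective; map-++; map-∘; map-cong; map-cong-local; map-id; upTo-∷ʳ)
open import Data.List.Membership.Propositional using (_∈_; _∉_; find; lose)
open import Data.List.Membership.Propositional.Properties
  using (∈-map⁺; ∈-map⁻; ∈-++⁺ˡ; ∈-++⁺ʳ; ∈-++⁻; ∈-concatMap⁺; ∈-concatMap⁻; ∈-upTo⁺; ∈-upTo⁻)
open import Data.List.Relation.Unary.Any using (here; there)
open import Data.List.Relation.Unary.All as All using (All; []; _∷_)
import Data.List.Relation.Unary.All.Properties as All
open import Data.List.Relation.Unary.Linked as Linked using (Linked; []; [-]; _∷_)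
open import Data.List.Relation.Unary.Linked.Properties using (Linked⇒All)
open import Data.List.Relation.Unary.Unique.Propositional using (Unique)
import Data.List.Relation.Unary.Unique.Propositional.Properties as Unique
open import Data.List.Relation.Unary.AllPairs using ([]; _∷_)
open import Data.List.Relation.Binary.Disjoint.Propositional using (Disjoint)
open import Data.List.Relation.Binary.Sublist.Propositional {A = ℕ} as Sublist
  using (_⊆_; []; _∷_; _∷ʳ_; ⊆-refl; ⊆-trans; minimum)
open import Data.List.Relation.Binary.Sublist.Propositional.Properties using (++⁺; ++⁺ˡ; ∷ˡ⁻)
open import Data.List.Relation.Binary.Permutation.Propositional using (_↭_; ↭-refl; ↭-sym; ↭-trans; prep; ↭⇒↭ₛ)
import Data.List.Relation.Binary.Permutation.Propositional.Properties as Perm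
import Data.List.Relation.Binary.Permutation.Setoid.Properties as PermₛProp
open import Data.Product using (_×_; _,_; ∃; ∃₂; Σ; proj₁; proj₂)
open import Data.Sum using (inj₁; inj₂)
open import Data.Unit using (tt)
open import Data.Empty using (⊥-elim)
open import Function using (_∘_; id)
open import Function.Bundles using (_⇔_; mk⇔)
open import Algebra.Properties.CommutativeSemigroup +-commutativeSemigroup using (interchange)
open import Relation.Nullary using (¬_; Dec; yes; no; does; _×-dec_)
open import Relation.Nullary.Decidable using (dec-true; dec-false)
open import Relation.Binary.Definitions using (tri<; tri≈; tri>)
open import Relation.Binary.PropositionalEquality
open ≡-Reasoning

Σ< : ℕ → (ℕ → ℕ) → ℕ
Σ< zero    f = 0
Σ< (suc n) f = f 0 + Σ< n (f ∘ suc)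

Σ<-cong : ∀ n {f g : ℕ → ℕ} → (∀ d → f d ≡ g d) → Σ< n f ≡ Σ< n g
Σ<-cong zero    eq = refl
Σ<-cong (suc n) eq = cong₂ _+_ (eq 0) (Σ<-cong n (eq ∘ suc))

Σ<-+ : ∀ n (f g : ℕ → ℕ) → Σ< n (λ d → f d + g d) ≡ Σ< n f + Σ< n g
Σ<-+ zero    f g = refl
Σ<-+ (suc n) f g = begin
  f 0 + g 0 + Σ< n (λ d → f (suc d) + g (suc d))
    ≡⟨ cong (f 0 + g 0 +_) (Σ<-+ n (f ∘ suc) (g ∘ suc)) ⟩
  f 0 + g 0 + (Σ< n (f ∘ suc) + Σ< n (g ∘ suc))
    ≡⟨ interchange (f 0) (g 0) _ _ ⟩
  f 0 + Σ< n (f ∘ suc) + (g 0 + Σ< n (g ∘ suc)) ∎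

Σ<-snoc : ∀ n f → Σ< (suc n) f ≡ Σ< n f + f n
Σ<-snoc zero    f = +-identityʳ (f 0)
Σ<-snoc (suc n) f = begin
  f 0 + Σ< (suc n) (f ∘ suc)         ≡⟨ cong (f 0 +_) (Σ<-snoc n (f ∘ suc)) ⟩
  f 0 + (Σ< n (f ∘ suc) + f (suc n)) ≡⟨ +-assoc (f 0) _ _ ⟨
  f 0 + Σ< n (f ∘ suc) + f (suc n)   ∎

sum-upTo : ∀ n (f : ℕ → ℕ) → sum (map f (upTo n)) ≡ Σ< n f
sum-upTo n f = go n id
  where
  go : ∀ n (g : ℕ → ℕ) → sum (map f (applyUpTo g n)) ≡ Σ< n (f ∘ g)
  go zero    g = refl
  go (suc n) g = cong (f (g 0) +_) (go n (g ∘ suc))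

binomial : ℕ → (ℕ → ℕ) → ℕ
binomial n f = Σ< (suc n) (λ d → (n C d) * f d)

binomial-+ : ∀ n f g → binomial n (λ d → f d + g d) ≡ binomial n f + binomial n g
binomial-+ n f g = trans (Σ<-cong (suc n) (λ d → *-distribˡ-+ (n C d) (f d) (g d)))
                         (Σ<-+ (suc n) (λ d → (n C d) * f d) (λ d → (n C d) * g d))

binomial-sum : ∀ n {A : Set} (g : A → ℕ → ℕ) xs →
  sum (map (λ i → binomial n (g i)) xs) ≡ binomial n (λ d → sum (map (λ i → g i d) xs))
binomial-sum n g []       = sym (trans (Σ<-cong (suc n) (λ d → *-zeroʳ (n C d))) (zero-sum (suc n)))
  where
  zero-sum : ∀ m → Σ< m (λ _ → 0) ≡ 0
  zero-sum zero    = refl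
  zero-sum (suc m) = zero-sum m
binomial-sum n g (x ∷ xs) = trans (cong (binomial n (g x) +_) (binomial-sum n g xs))
                                  (sym (binomial-+ n (g x) (λ d → sum (map (λ i → g i d) xs))))

-- Pascal's rule, lifted to the transform: T f (n+1) = T f n + T (f ∘ suc) n.
binomial-suc : ∀ n f → binomial (suc n) f ≡ binomial n f + binomial n (f ∘ suc)
binomial-suc n f = begin
  1 * f 0 + Σ< (suc n) (λ d → (suc n C suc d) * f (suc d))
    ≡⟨ cong (1 * f 0 +_) (Σ<-cong (suc n) pascal) ⟩
  1 * f 0 + Σ< (suc n) (λ d → (n C d) * f (suc d) + (n C suc d) * f (suc d))
    ≡⟨ cong (1 * f 0 +_) (Σ<-+ (suc n) (λ d → (n C d) * f (suc d)) (λ d → (n C suc d) * f (suc d))) ⟩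
  1 * f 0 + (binomial n (f ∘ suc) + Σ< (suc n) (λ d → (n C suc d) * f (suc d)))
    ≡⟨ cong (λ z → 1 * f 0 + (binomial n (f ∘ suc) + z)) (Σ<-snoc n _) ⟩
  1 * f 0 + (binomial n (f ∘ suc) + (Σ< n (λ d → (n C suc d) * f (suc d)) + (n C suc n) * f (suc n)))
    ≡⟨ cong (λ z → 1 * f 0 + (binomial n (f ∘ suc) + (Σ< n (λ d → (n C suc d) * f (suc d)) + z * f (suc n))))
            (k>n⇒nCk≡0 (n<1+n n)) ⟩
  1 * f 0 + (binomial n (f ∘ suc) + (Σ< n (λ d → (n C suc d) * f (suc d)) + 0))
    ≡⟨ rearrange (1 * f 0) (binomial n (f ∘ suc)) _ ⟩
  binomial n f + binomial n (f ∘ suc) ∎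
  where
  rearrange : ∀ a b x → a + (b + (x + 0)) ≡ a + x + b
  rearrange = solve-∀
  pascal : ∀ d → (suc n C suc d) * f (suc d) ≡ (n C d) * f (suc d) + (n C suc d) * f (suc d)
  pascal d = trans (cong (_* f (suc d)) (sym (nCk+nC[k+1]≡[n+1]C[k+1] n d)))
                   (*-distribʳ-+ (f (suc d)) (n C d) (n C suc d))

-- A generating rule assigns to every label the list of labels of the
-- children of a node with that label; 'leaves rule L d' counts the nodes at
-- depth d below a node labelled L.
Rule : Set
Rule = ℕ → List ℕ

leaves : Rule → ℕ → ℕ → ℕ
leaves rule L zero    = 1
leaves rule L (suc d) = sum (map (λ i → leaves rule i d) (rule L))

-- Giving every node one extra child with its own label (a "self-loop")
-- replaces the level counts by their binomial transform: a path of length n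
-- in the enlarged tree is a path of length d in the old one with n - d
-- stationary steps interleaved.
selfLoop : (rule₁ rule₂ : Rule) → (∀ L → rule₁ L ↭ L ∷ rule₂ L) →
  ∀ n L → leaves rule₁ L n ≡ binomial n (leaves rule₂ L)
selfLoop rule₁ rule₂ loop zero    L = refl
selfLoop rule₁ rule₂ loop (suc n) L = begin
  sum (map (λ i → leaves rule₁ i n) (rule₁ L))
    ≡⟨ cong sum (map-cong (selfLoop rule₁ rule₂ loop n) (rule₁ L)) ⟩
  sum (map (λ i → binomial n (leaves rule₂ i)) (rule₁ L))
    ≡⟨ binomial-sum n (leaves rule₂) (rule₁ L) ⟩
  binomial n (λ d → sum (map (λ i → leaves rule₂ i d) (rule₁ L)))
    ≡⟨ Σ<-cong (suc n) (λ d → cong ((n C d) *_) (sum-↭ (Perm.map⁺ (λ i → leaves rule₂ i d) (loop L)))) ⟩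
  binomial n (λ d → leaves rule₂ L d + leaves rule₂ L (suc d))
    ≡⟨ binomial-+ n (leaves rule₂ L) (leaves rule₂ L ∘ suc) ⟩
  binomial n (leaves rule₂ L) + binomial n (leaves rule₂ L ∘ suc)
    ≡⟨ binomial-suc n (leaves rule₂ L) ⟨
  binomial (suc n) (leaves rule₂ L) ∎

weight : {X : Set} → (X → ℕ) → Rule → ℕ → List X → ℕ
weight label rule d xs = sum (map (λ x → leaves rule (label x) d) xs)

weight-zero : {X : Set} (label : X → ℕ) (rule : Rule) (xs : List X) → weight label rule 0 xs ≡ length xs
weight-zero label rule []       = refl
weight-zero label rule (x ∷ xs) = cong suc (weight-zero label rule xs)

weight-children : {X : Set} (label : X → ℕ) (rule : Rule) (children : X → List X) (d : ℕ) (xs : List X) →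
  (∀ {x} → x ∈ xs → map label (children x) ≡ rule (label x)) →
  weight label rule d (concatMap children xs) ≡ weight label rule (suc d) xs
weight-children label rule children d []       follows = refl
weight-children label rule children d (x ∷ xs) follows = begin
  sum (map f (children x ++ concatMap children xs))
    ≡⟨ cong sum (map-++ f (children x) _) ⟩
  sum (map f (children x) ++ map f (concatMap children xs))
    ≡⟨ sum-++ (map f (children x)) _ ⟩
  sum (map f (children x)) + weight label rule d (concatMap children xs)
    ≡⟨ cong₂ _+_ children-sum (weight-children label rule children d xs (follows ∘ there)) ⟩
  leaves rule (label x) (suc d) + weight label rule (suc d) xs ∎
  where
  f = λ y → leaves rule (label y) d
  children-sum : sum (map f (children x)) ≡ leaves rule (label x) (suc d)
  children-sum = cong sum (trans (map-∘ (children x)) (cong (map (λ i → leaves rule i d)) (follows (here refl))))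

descendTo2 : ℕ → List ℕ
descendTo2 zero                = []
descendTo2 (suc zero)          = []
descendTo2 (suc (suc k))       = suc (suc k) ∷ descendTo2 (suc k)

-- The classical generating tree of the Catalan numbers:  (L) ↦ (2) (3) … (L+1).
catalanRule : Rule
catalanRule L = descendTo2 L ++ suc L ∷ []

catalanRule-step : ∀ l (f : ℕ → ℕ) →
  sum (map f (catalanRule (suc (suc l)))) ≡ sum (map f (catalanRule (suc l))) + f (suc (suc (suc l)))
catalanRule-step l f = begin
  f (suc (suc l)) + sum (map f (D ++ suc (suc (suc l)) ∷ []))
    ≡⟨ cong (f (suc (suc l)) +_) (sum-snoc D (suc (suc (suc l)))) ⟩
  f (suc (suc l)) + (sum (map f D) + f (suc (suc (suc l))))
    ≡⟨ rearrange (f (suc (suc l))) (sum (map f D)) _ ⟩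
  (sum (map f D) + f (suc (suc l))) + f (suc (suc (suc l)))
    ≡⟨ cong (_+ f (suc (suc (suc l)))) (sum-snoc D (suc (suc l))) ⟨
  sum (map f (catalanRule (suc l))) + f (suc (suc (suc l))) ∎
  where
  D = descendTo2 (suc l)
  sum-snoc : ∀ xs x → sum (map f (xs ++ x ∷ [])) ≡ sum (map f xs) + f x
  sum-snoc xs x = begin
    sum (map f (xs ++ x ∷ []))          ≡⟨ cong sum (map-++ f xs (x ∷ [])) ⟩
    sum (map f xs ++ f x ∷ [])          ≡⟨ sum-++ (map f xs) (f x ∷ []) ⟩
    sum (map f xs) + (f x + 0)          ≡⟨ cong (sum (map f xs) +_) (+-identityʳ (f x)) ⟩
    sum (map f xs) + f x                ∎
  rearrange : ∀ a b x → a + (b + x) ≡ (b + a) + x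
  rearrange = solve-∀

binomBelow : ℕ → ℕ → ℕ
binomBelow N zero    = 0
binomBelow N (suc d) = N C d

pascal : ∀ N d → suc N C d ≡ binomBelow N d + N C d
pascal N zero    = refl
pascal N (suc d) = sym (nCk+nC[k+1]≡[n+1]C[k+1] N d)

binom-sym : ∀ k j → (k + j) C k ≡ (k + j) C j
binom-sym k j = trans (nCk≡nC[n∸k] (m≤m+n k j)) (cong ((k + j) C_) (m+n∸m≡n k j))

-- The ballot theorem in the Catalan tree: from label l + 1 there are
-- (N choose d) - (N choose d - 1) paths of length d, where N = l + 2d.
ballot : ∀ d l N → N ≡ l + (d + d) → leaves catalanRule (suc l) d + binomBelow N d ≡ N C d
ballot zero    l       N eq = refl
ballot (suc d) zero    N eq rewrite trans eq (cong suc (+-suc d d)) = begin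
  leaves catalanRule 2 d + 0 + suc K C d
    ≡⟨ cong₂ _+_ (+-identityʳ (leaves catalanRule 2 d)) (pascal K d) ⟩
  leaves catalanRule 2 d + (binomBelow K d + K C d)
    ≡⟨ +-assoc (leaves catalanRule 2 d) _ _ ⟨
  leaves catalanRule 2 d + binomBelow K d + K C d
    ≡⟨ cong (_+ K C d) (ballot d 1 K refl) ⟩
  K C d + K C d
    ≡⟨ cong (K C d +_) middle ⟩
  K C d + K C suc d
    ≡⟨ nCk+nC[k+1]≡[n+1]C[k+1] K d ⟩
  suc K C suc d ∎
  where
  K = suc (d + d)
  middle : K C d ≡ K C suc d
  middle = subst (λ m → m C d ≡ m C suc d) (+-suc d d) (binom-sym d (suc d))
ballot (suc d) (suc l) N refl = begin
  leaves catalanRule (suc (suc l)) (suc d) + (suc M C d)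
    ≡⟨ cong₂ _+_ (catalanRule-step l (λ i → leaves catalanRule i d)) (pascal M d) ⟩
  (leaves catalanRule (suc l) (suc d) + leaves catalanRule (suc (suc (suc l))) d) + (binomBelow M d + M C d)
    ≡⟨ rearrange (leaves catalanRule (suc l) (suc d)) _ _ _ ⟩
  (leaves catalanRule (suc l) (suc d) + M C d) + (leaves catalanRule (suc (suc (suc l))) d + binomBelow M d)
    ≡⟨ cong₂ _+_ (ballot (suc d) l M refl) (ballot d (suc (suc l)) M (shuffle l d)) ⟩
  M C suc d + M C d
    ≡⟨ +-comm (M C suc d) (M C d) ⟩
  M C d + M C suc d
    ≡⟨ nCk+nC[k+1]≡[n+1]C[k+1] M d ⟩
  suc M C suc d ∎
  where
  M = l + (suc d + suc d)
  shuffle : ∀ l d → l + (suc d + suc d) ≡ suc (suc l) + (d + d)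
  shuffle = solve-∀
  rearrange : ∀ a b x y → (a + b) + (x + y) ≡ (a + y) + (b + x)
  rearrange = solve-∀

absorb : ∀ n k → suc k * (suc n C suc k) ≡ suc n * (n C k)
absorb zero    zero    = refl
absorb zero    (suc k) = begin
  suc (suc k) * (1 C suc (suc k)) ≡⟨ cong (suc (suc k) *_) (k>n⇒nCk≡0 {1} {suc (suc k)} (s≤s (s≤s z≤n))) ⟩
  suc (suc k) * 0                 ≡⟨ *-zeroʳ (suc (suc k)) ⟩
  0                               ≡⟨ cong (1 *_) (k>n⇒nCk≡0 {0} {suc k} (s≤s z≤n)) ⟨
  1 * (0 C suc k)                 ∎
absorb (suc n) zero    = trans (+-identityʳ _) (trans (nC1≡n (suc (suc n))) (sym (*-identityʳ (suc (suc n)))))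
absorb (suc n) (suc k) = begin
  suc (suc k) * (suc (suc n) C suc (suc k))
    ≡⟨ cong (suc (suc k) *_) (nCk+nC[k+1]≡[n+1]C[k+1] (suc n) (suc k)) ⟨
  suc (suc k) * (suc n C suc k + suc n C suc (suc k))
    ≡⟨ expand k (suc n C suc k) (suc n C suc (suc k)) ⟩
  suc k * (suc n C suc k) + suc n C suc k + suc (suc k) * (suc n C suc (suc k))
    ≡⟨ cong₂ (λ a b → a + suc n C suc k + b) (absorb n k) (absorb n (suc k)) ⟩
  suc n * (n C k) + suc n C suc k + suc n * (n C suc k)
    ≡⟨ collect (suc n) (n C k) (suc n C suc k) (n C suc k) ⟩
  suc n * (n C k + n C suc k) + suc n C suc k
    ≡⟨ cong (λ z → suc n * z + suc n C suc k) (nCk+nC[k+1]≡[n+1]C[k+1] n k) ⟩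
  suc n * (suc n C suc k) + suc n C suc k
    ≡⟨ +-comm (suc n * (suc n C suc k)) _ ⟩
  suc (suc n) * (suc n C suc k) ∎
  where
  expand : ∀ k a b → suc (suc k) * (a + b) ≡ suc k * a + a + suc (suc k) * b
  expand = solve-∀
  collect : ∀ m a x b → m * a + x + m * b ≡ m * (a + b) + x
  collect = solve-∀

cancel-ratio : ∀ a c X Y → c + Y ≡ X → suc a * Y ≡ a * X → c * suc a ≡ X
cancel-ratio a c X Y sum-eq ratio-eq = trans (*-comm c (suc a)) (+-cancelʳ-≡ (a * X) _ _ (begin
  suc a * c + a * X       ≡⟨ cong (suc a * c +_) ratio-eq ⟨
  suc a * c + suc a * Y   ≡⟨ *-distribˡ-+ (suc a) c Y ⟨
  suc a * (c + Y)         ≡⟨ cong (suc a *_) sum-eq ⟩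
  suc a * X               ∎))

catalan≡leaves : ∀ d → catalan d ≡ leaves catalanRule 1 d
catalan≡leaves zero    = refl
catalan≡leaves (suc e) = begin
  ((2 * suc e) C suc e) / suc (suc e)      ≡⟨ cong (λ z → (z C suc e) / suc (suc e)) (double e) ⟩
  X / suc (suc e)                          ≡⟨ cong (_/ suc (suc e)) times-succ ⟨
  (c * suc (suc e)) / suc (suc e)          ≡⟨ m*n/n≡m c (suc (suc e)) ⟩
  c                                        ∎
  where
  K = suc (e + e)
  X = suc K C suc e
  Y = suc K C e
  c = leaves catalanRule 1 (suc e)
  double : ∀ e → 2 * suc e ≡ suc (suc (e + e))
  double = solve-∀
  c+Y≡X : c + Y ≡ X
  c+Y≡X = ballot (suc e) 0 (suc K) (cong suc (sym (+-suc e e)))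
  ratio : suc (suc e) * Y ≡ suc e * X
  ratio = begin
    suc (suc e) * Y                       ≡⟨ cong (suc (suc e) *_) sym₂ ⟩
    suc (suc e) * (suc K C suc (suc e))   ≡⟨ absorb K (suc e) ⟩
    suc K * (K C suc e)                   ≡⟨ cong (suc K *_) sym₁ ⟨
    suc K * (K C e)                       ≡⟨ absorb K e ⟨
    suc e * X                             ∎
    where
    sym₁ : K C e ≡ K C suc e
    sym₁ = subst (λ m → m C e ≡ m C suc e) (+-suc e e) (binom-sym e (suc e))
    sym₂ : suc K C e ≡ suc K C suc (suc e)
    sym₂ = subst (λ m → m C e ≡ m C suc (suc e)) (trans (+-suc e (suc e)) (cong suc (+-suc e e)))
                 (binom-sym e (suc (suc e)))
  times-succ : c * suc (suc e) ≡ X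
  times-succ = cancel-ratio (suc e) c X Y c+Y≡X ratio

-- The generating tree of 321-avoiding flattened partitions (established
-- below):  (L) ↦ (2) (3) … (L) (L) (L+1).  It is the Catalan tree with a
-- self-loop added.
flattenRule : Rule
flattenRule L = descendTo2 L ++ L ∷ suc L ∷ []

flattenRule-selfLoop : ∀ L → flattenRule L ↭ L ∷ catalanRule L
flattenRule-selfLoop L = Perm.shift L (descendTo2 L) (suc L ∷ [])

leaves-flattenRule : ∀ n → leaves flattenRule 1 n ≡ binomCatalanSum n
leaves-flattenRule n = begin
  leaves flattenRule 1 n                             ≡⟨ selfLoop flattenRule catalanRule flattenRule-selfLoop n 1 ⟩
  binomial n (leaves catalanRule 1)                  ≡⟨ Σ<-cong (suc n) (λ d → cong ((n C d) *_) (catalan≡leaves d)) ⟨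
  Σ< (suc n) (λ d → (n C d) * catalan d)             ≡⟨ sum-upTo (suc n) (λ d → (n C d) * catalan d) ⟨
  binomCatalanSum n                                  ∎

Increasing : List ℕ → Set
Increasing = Linked _<_

Has321 : List ℕ → Set
Has321 p = ∃ λ a → ∃ λ b → ∃ λ c → (a ∷ b ∷ c ∷ []) ⊆ p × b < a × c < b

position₁ : ∀ {a xs p} → (a ∷ xs) ⊆ p → Σ (Fin (length p)) λ i → lookup p i ≡ a
position₁ (_ ∷ʳ σ) with position₁ σ
... | i , eq = suc i , eq
position₁ (refl ∷ σ) = zero , refl

position₂ : ∀ {a b xs p} → (a ∷ b ∷ xs) ⊆ p →
  Σ (Fin (length p)) λ i → Σ (Fin (length p)) λ j → i <ᶠ j × lookup p i ≡ a × lookup p j ≡ b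
position₂ (_ ∷ʳ σ) with position₂ σ
... | i , j , i<j , eq₁ , eq₂ = suc i , suc j , s≤s i<j , eq₁ , eq₂
position₂ (refl ∷ σ) with position₁ σ
... | j , eq = zero , suc j , s≤s z≤n , refl , eq

position₃ : ∀ {a b c xs p} → (a ∷ b ∷ c ∷ xs) ⊆ p →
  Σ (Fin (length p)) λ i → Σ (Fin (length p)) λ j → Σ (Fin (length p)) λ k →
  i <ᶠ j × j <ᶠ k × lookup p i ≡ a × lookup p j ≡ b × lookup p k ≡ c
position₃ (_ ∷ʳ σ) with position₃ σ
... | i , j , k , i<j , j<k , eq₁ , eq₂ , eq₃ = suc i , suc j , suc k , s≤s i<j , s≤s j<k , eq₁ , eq₂ , eq₃
position₃ (refl ∷ σ) with position₂ σ
... | j , k , j<k , eq₂ , eq₃ = zero , suc j , suc k , s≤s z≤n , s≤s j<k , refl , eq₂ , eq₃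

select₁ : ∀ p (i : Fin (length p)) → (lookup p i ∷ []) ⊆ p
select₁ (x ∷ p) zero    = refl ∷ minimum p
select₁ (x ∷ p) (suc i) = x ∷ʳ select₁ p i

select₂ : ∀ p (i j : Fin (length p)) → i <ᶠ j → (lookup p i ∷ lookup p j ∷ []) ⊆ p
select₂ (x ∷ p) zero    (suc j) _         = refl ∷ select₁ p j
select₂ (x ∷ p) (suc i) (suc j) (s≤s i<j) = x ∷ʳ select₂ p i j i<j

select₃ : ∀ p (i j k : Fin (length p)) → i <ᶠ j → j <ᶠ k → (lookup p i ∷ lookup p j ∷ lookup p k ∷ []) ⊆ p
select₃ (x ∷ p) zero    (suc j) (suc k) _         (s≤s j<k) = refl ∷ select₂ p j k j<k
select₃ (x ∷ p) (suc i) (suc j) (suc k) (s≤s i<j) (s≤s j<k) = x ∷ʳ select₃ p i j k i<j j<k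

avoids⇒¬Has321 : ∀ p → Avoids321 p → ¬ Has321 p
avoids⇒¬Has321 p avoids (a , b , c , σ , b<a , c<b) with position₃ σ
... | i , j , k , i<j , j<k , refl , refl , refl = avoids i j k i<j j<k (b<a , c<b)

¬Has321⇒avoids : ∀ p → ¬ Has321 p → Avoids321 p
¬Has321⇒avoids p free i j k i<j j<k (b<a , c<b) = free (_ , _ , _ , select₃ p i j k i<j j<k , b<a , c<b)

¬Has321-⊆ : ∀ {p q} → q ⊆ p → ¬ Has321 p → ¬ Has321 q
¬Has321-⊆ τ free (a , b , c , σ , h) = free (a , b , c , ⊆-trans σ τ , h)

¬Has321-suffix : ∀ X {Y} → ¬ Has321 (X ++ Y) → ¬ Has321 Y
¬Has321-suffix X = ¬Has321-⊆ (++⁺ˡ X ⊆-refl)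

split-⊆ : ∀ X {Y xs} → xs ⊆ X ++ Y → ∃₂ λ xs₁ xs₂ → xs ≡ xs₁ ++ xs₂ × xs₁ ⊆ X × xs₂ ⊆ Y
split-⊆ []      σ          = [] , _ , refl , [] , σ
split-⊆ (x ∷ X) (_ ∷ʳ σ)   with split-⊆ X σ
... | xs₁ , xs₂ , refl , σ₁ , σ₂ = xs₁ , xs₂ , refl , x ∷ʳ σ₁ , σ₂
split-⊆ (x ∷ X) (refl ∷ σ) with split-⊆ X σ
... | xs₁ , xs₂ , refl , σ₁ , σ₂ = x ∷ xs₁ , xs₂ , refl , refl ∷ σ₁ , σ₂

increasing-pair : ∀ {S b c} → Increasing S → (b ∷ c ∷ []) ⊆ S → b < c
increasing-pair inc       (_ ∷ʳ σ)   = increasing-pair (Linked.tail inc) σ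
increasing-pair [-]       (refl ∷ ())
increasing-pair (r ∷ inc) (refl ∷ σ) = All.lookup (Linked⇒All <-trans r inc) (Sublist.lookup σ (here refl))

-- Inserting a new maximum m creates no 321 if everything after it increases:
-- m can only play the role of the '3', and then the '2' and '1' would form a
-- descent after m.
¬Has321-insert : ∀ A m S → All (_< m) A → Increasing S → ¬ Has321 (A ++ S) → ¬ Has321 (A ++ m ∷ S)
¬Has321-insert A m S A<m incS free (a , b , c , σ , b<a , c<b) with split-⊆ A σ
... | xs₁ , []      , eq , σ₁ , _ ∷ʳ σ₂  = free (a , b , c , subst (_⊆ A ++ S) (sym eq) (++⁺ σ₁ σ₂) , b<a , c<b)
... | xs₁ , _ ∷ _   , eq , σ₁ , _ ∷ʳ σ₂  = free (a , b , c , subst (_⊆ A ++ S) (sym eq) (++⁺ σ₁ σ₂) , b<a , c<b)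
... | []              , _ ∷ _ , refl , σ₁ , refl ∷ σ₂ = <-asym c<b (increasing-pair incS σ₂)
... | _ ∷ []          , _ ∷ _ , refl , σ₁ , refl ∷ σ₂ = <-asym b<a (All.lookup A<m (Sublist.lookup σ₁ (here refl)))
... | _ ∷ _ ∷ []      , _ ∷ _ , refl , σ₁ , refl ∷ σ₂ = <-asym c<b (All.lookup A<m (Sublist.lookup (∷ˡ⁻ σ₁) (here refl)))
... | _ ∷ _ ∷ _ ∷ []     , _ ∷ _ , ()   , σ₁ , refl ∷ σ₂
... | _ ∷ _ ∷ _ ∷ _ ∷ _  , _ ∷ _ , ()   , σ₁ , refl ∷ σ₂

¬Has321-delete : ∀ A {m S} → ¬ Has321 (A ++ m ∷ S) → ¬ Has321 (A ++ S)
¬Has321-delete A {m} {S} = ¬Has321-⊆ (++⁺ (⊆-refl {x = A}) (m ∷ʳ ⊆-refl))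

increasing-after : ∀ X m S → All (_< m) S → Unique S → ¬ Has321 (X ++ m ∷ S) → Increasing S
increasing-after X m []          _              _              free = []
increasing-after X m (x ∷ [])    _              _              free = [-]
increasing-after X m (x ∷ y ∷ S) (x<m ∷ y<m ∷ S<m) (x∉ ∷ uniq) free with <-cmp x y
... | tri< x<y _ _ = x<y ∷ increasing-after X m (y ∷ S) (y<m ∷ S<m) uniq
                       (¬Has321-⊆ (++⁺ (⊆-refl {x = X}) (refl ∷ x ∷ʳ ⊆-refl)) free)
... | tri≈ _ x≡y _ = ⊥-elim (All.head x∉ x≡y)
... | tri> _ _ y<x = ⊥-elim (free (m , x , y , ++⁺ˡ X (refl ∷ refl ∷ refl ∷ minimum S) , x<m , y<x))

increasing? : (xs : List ℕ) → Dec (Increasing xs)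
increasing? = Linked.linked? _<?_

isIncreasing : List ℕ → Bool
isIncreasing xs = does (increasing? xs)

data Extends (m : ℕ) : List (List ℕ) → List (List ℕ) → Set where
  newBlock : Extends m [] ((m ∷ []) ∷ [])
  append   : ∀ {B Cs} → Increasing (concat Cs) → Extends m (B ∷ Cs) ((B ++ m ∷ []) ∷ Cs)
  later    : ∀ {B Cs C} → Extends m Cs C → Extends m (B ∷ Cs) (B ∷ C)

extends-shape : ∀ {m Π C} → Extends m Π C →
  ∃₂ λ A S → concat C ≡ A ++ m ∷ S × concat Π ≡ A ++ S × Increasing S
extends-shape newBlock                = [] , [] , refl , refl , []
extends-shape (append {B} {Cs} incCs) = B , concat Cs , ++-assoc B _ (concat Cs) , refl , incCs
extends-shape (later {B} e) with extends-shape e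
... | A , S , eqC , eqΠ , incS =
  B ++ A , S , trans (cong (B ++_) eqC) (sym (++-assoc B A _)) , trans (cong (B ++_) eqΠ) (sym (++-assoc B A S)) , incS

onlyIf : {A : Set} → Bool → A → List A
onlyIf true  x = x ∷ []
onlyIf false x = []

insertions : ℕ → List (List ℕ) → List (List (List ℕ))
insertions m []       = ((m ∷ []) ∷ []) ∷ []
insertions m (B ∷ Cs) = onlyIf (isIncreasing (concat Cs)) ((B ++ m ∷ []) ∷ Cs) ++ map (B ∷_) (insertions m Cs)

insertions-sound : ∀ m Π {C} → C ∈ insertions m Π → Extends m Π C
insertions-sound m []       (here refl) = newBlock
insertions-sound m (B ∷ Cs) C∈ with ∈-++⁻ (onlyIf (isIncreasing (concat Cs)) _) C∈
insertions-sound m (B ∷ Cs) C∈ | inj₁ C∈first with increasing? (concat Cs) | C∈first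
... | yes incCs | here refl = append incCs
insertions-sound m (B ∷ Cs) C∈ | inj₂ C∈rest with ∈-map⁻ (B ∷_) C∈rest
... | C′ , C′∈ , refl = later (insertions-sound m Cs C′∈)

insertions-complete : ∀ {m Π C} → Extends m Π C → C ∈ insertions m Π
insertions-complete newBlock                = here refl
insertions-complete (append {B} {Cs} incCs) with increasing? (concat Cs)
... | yes _      = here refl
... | no ¬incCs  = ⊥-elim (¬incCs incCs)
insertions-complete {m} (later {B} {Cs} e)  =
  ∈-++⁺ʳ (onlyIf (isIncreasing (concat Cs)) ((B ++ m ∷ []) ∷ Cs)) (∈-map⁺ (B ∷_) (insertions-complete e))

insertions-unique : ∀ m Π → Unique (insertions m Π)
insertions-unique m []       = [] ∷ []
insertions-unique m (B ∷ Cs) =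
  Unique.++⁺ (first (isIncreasing (concat Cs))) (Unique.map⁺ (proj₂ ∘ ∷-injective) (insertions-unique m Cs)) disjoint
  where
  first : ∀ b → Unique (onlyIf b ((B ++ m ∷ []) ∷ Cs))
  first true  = [] ∷ []
  first false = []
  snoc≢ : ∀ (B : List ℕ) → B ++ m ∷ [] ≢ B
  snoc≢ (x ∷ B) eq = snoc≢ B (proj₂ (∷-injective eq))
  disjoint : Disjoint (onlyIf (isIncreasing (concat Cs)) ((B ++ m ∷ []) ∷ Cs)) (map (B ∷_) (insertions m Cs))
  disjoint (C∈first , C∈rest) with increasing? (concat Cs) | C∈first | ∈-map⁻ (B ∷_) C∈rest
  ... | yes _ | here refl | _ , _ , eq = snoc≢ B (proj₁ (∷-injective eq))

increasing-snoc : ∀ B m → Increasing B → All (_< m) B → Increasing (B ++ m ∷ [])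
increasing-snoc []          m _         _          = [-]
increasing-snoc (x ∷ [])    m _         (x<m ∷ _)  = x<m ∷ [-]
increasing-snoc (x ∷ y ∷ B) m (r ∷ inc) (_ ∷ B<m)  = r ∷ increasing-snoc (y ∷ B) m inc B<m

increasing-prefix : ∀ X {Y} → Increasing (X ++ Y) → Increasing X
increasing-prefix []          _         = []
increasing-prefix (x ∷ [])    _         = [-]
increasing-prefix (x ∷ y ∷ X) (r ∷ inc) = r ∷ increasing-prefix (y ∷ X) inc

-- The ordering of blocks only looks at their first entries.
firstLt-changeTail : ∀ {x X Y Ds} → Linked FirstLt ((x ∷ X) ∷ Ds) → Linked FirstLt ((x ∷ Y) ∷ Ds)
firstLt-changeTail {Ds = []}          _       = [-]
firstLt-changeTail {Ds = [] ∷ _}      (() ∷ _)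
firstLt-changeTail {Ds = (_ ∷ _) ∷ _} (r ∷ l) = r ∷ l

extends-nonEmpty : ∀ {m Π C} → Extends m Π C → All NonEmptyBlock Π → All NonEmptyBlock C
extends-nonEmpty newBlock                    _          = tt ∷ []
extends-nonEmpty (append {x ∷ X} _)          (_ ∷ ne)   = tt ∷ ne
extends-nonEmpty (later e)                   (nB ∷ ne)  = nB ∷ extends-nonEmpty e ne

extends-blocks : ∀ {m Π C} → Extends m Π C → All (_< m) (concat Π) → All Increasing Π → All Increasing C
extends-blocks newBlock             _   _           = [-] ∷ []
extends-blocks (append {B} _)       bnd (incB ∷ inc) = increasing-snoc B _ incB (All.++⁻ˡ B bnd) ∷ inc
extends-blocks (later {B} e)        bnd (incB ∷ inc) = incB ∷ extends-blocks e (All.++⁻ʳ B bnd) inc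

extends-order′ : ∀ {m x X Π C} → x < m → Extends m Π C → All NonEmptyBlock Π → All (_< m) (concat Π) →
  Linked FirstLt ((x ∷ X) ∷ Π) → Linked FirstLt ((x ∷ X) ∷ C)
extends-order′ x<m newBlock              _        _           _       = x<m ∷ [-]
extends-order′ x<m (append {y ∷ Y} _)    _        _           (r ∷ l) = r ∷ firstLt-changeTail l
extends-order′ x<m (later {y ∷ Y} e)     (_ ∷ ne) (y<m ∷ bnd) (r ∷ l) =
  r ∷ extends-order′ y<m e ne (All.++⁻ʳ Y bnd) l

extends-order : ∀ {m Π C} → Extends m Π C → All NonEmptyBlock Π → All (_< m) (concat Π) →
  Linked FirstLt Π → Linked FirstLt C
extends-order newBlock             _        _           _ = [-]
extends-order (append {[]} _)      (() ∷ _) _           _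
extends-order (append {y ∷ Y} _)   _        _           l = firstLt-changeTail l
extends-order (later {y ∷ Y} e)    (_ ∷ ne) (y<m ∷ bnd) l = extends-order′ y<m e ne (All.++⁻ʳ Y bnd) l

restricts-blocks : ∀ {m Π C} → Extends m Π C → All Increasing C → All Increasing Π
restricts-blocks newBlock          _            = []
restricts-blocks (append {B} _)    (incB ∷ inc) = increasing-prefix B incB ∷ inc
restricts-blocks (later e)         (incB ∷ inc) = incB ∷ restricts-blocks e inc

restricts-order′ : ∀ {m x X Π C} → Extends m Π C → All NonEmptyBlock Π →
  Linked FirstLt ((x ∷ X) ∷ C) → Linked FirstLt ((x ∷ X) ∷ Π)
restricts-order′ newBlock            _        _       = [-]
restricts-order′ (append {[]} _)     (() ∷ _) _
restricts-order′ (append {y ∷ Y} _)  _        (r ∷ l) = r ∷ firstLt-changeTail l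
restricts-order′ (later {y ∷ Y} e)   (_ ∷ ne) (r ∷ l) = r ∷ restricts-order′ e ne l

restricts-order : ∀ {m Π C} → Extends m Π C → All NonEmptyBlock Π → Linked FirstLt C → Linked FirstLt Π
restricts-order newBlock            _        _ = []
restricts-order (append {[]} _)     (() ∷ _) _
restricts-order (append {y ∷ Y} _)  _        l = firstLt-changeTail l
restricts-order (later {y ∷ Y} e)   (_ ∷ ne) l = restricts-order′ e ne l

range-suc : ∀ k → range (suc k) ≡ range k ++ suc k ∷ []
range-suc k = trans (cong (map suc) (sym (upTo-∷ʳ k))) (map-++ suc (upTo k) (k ∷ []))

range-bound : ∀ k → All (_< suc k) (range k)
range-bound k = All.tabulate bound
  where
  bound : ∀ {x} → x ∈ range k → x < suc k
  bound x∈ with ∈-map⁻ suc x∈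
  ... | y , y∈ , refl = s≤s (∈-upTo⁻ y∈)

range-unique : ∀ k → Unique (range k)
range-unique k = Unique.map⁺ suc-injective (Unique.upTo⁺ k)

max∈range : ∀ k → suc k ∈ range (suc k)
max∈range k = ∈-map⁺ suc (∈-upTo⁺ (n<1+n k))

perm-insert : ∀ k A S → A ++ S ↭ range k → A ++ suc k ∷ S ↭ range (suc k)
perm-insert k A S p = ↭-trans (Perm.shift (suc k) A S) (↭-trans (prep (suc k) p)
  (subst (suc k ∷ range k ↭_) (sym (range-suc k)) (Perm.++-comm (suc k ∷ []) (range k))))

perm-delete : ∀ k A S → A ++ suc k ∷ S ↭ range (suc k) → A ++ S ↭ range k
perm-delete k A S p = subst (A ++ S ↭_) (++-identityʳ (range k))
  (Perm.drop-mid A (range k) (subst (A ++ suc k ∷ S ↭_) (range-suc k) p))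

std-bound : ∀ {k Π} → IsStdPartition k Π → All (_< suc k) (concat Π)
std-bound (_ , _ , _ , p) = Perm.All-resp-↭ (↭-sym p) (range-bound _)

std-unique : ∀ {k Π} → IsStdPartition k Π → Unique (concat Π)
std-unique (_ , _ , _ , p) = PermₛProp.Unique-resp-↭ (setoid ℕ) (↭⇒↭ₛ (↭-sym p)) (range-unique _)

extends-std : ∀ {k Π C} → Extends (suc k) Π C → IsStdPartition k Π → ¬ Has321 (concat Π) →
  IsStdPartition (suc k) C × ¬ Has321 (concat C)
extends-std {k} {Π} {C} e std@(ne , inc , ord , p) free with extends-shape e
... | A , S , eqC , eqΠ , incS =
  (extends-nonEmpty e ne , extends-blocks e bnd inc , extends-order e ne bnd ord ,
   subst (_↭ range (suc k)) (sym eqC) (perm-insert k A S (subst (_↭ range k) eqΠ p))) ,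
  subst (¬_ ∘ Has321) (sym eqC)
    (¬Has321-insert A (suc k) S (All.++⁻ˡ A (subst (All (_< suc k)) eqΠ bnd)) incS (subst (¬_ ∘ Has321) eqΠ free))
  where
  bnd = std-bound std

restricts-std : ∀ {k Π C} → Extends (suc k) Π C → All NonEmptyBlock Π → IsStdPartition (suc k) C →
  ¬ Has321 (concat C) → IsStdPartition k Π × ¬ Has321 (concat Π)
restricts-std {k} e ne (_ , inc , ord , p) free with extends-shape e
... | A , S , eqC , eqΠ , _ =
  (ne , restricts-blocks e inc , restricts-order e ne ord ,
   subst (_↭ range k) (sym eqΠ) (perm-delete k A S (subst (_↭ range (suc k)) eqC p))) ,
  subst (¬_ ∘ Has321) (sym eqΠ) (¬Has321-delete A (subst (¬_ ∘ Has321) eqC free))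

unique-suffix : ∀ X {Y : List ℕ} → Unique (X ++ Y) → Unique Y
unique-suffix []      uniq       = uniq
unique-suffix (x ∷ X) (_ ∷ uniq) = unique-suffix X uniq

below-max : ∀ X {m S} → Unique (X ++ m ∷ S) → All (_< suc m) S → All (_< m) S
below-max X {m} uniq bnd with unique-suffix X uniq
... | m∉S ∷ _ = All.zipWith (λ (x<1+m , m≢x) → ≤∧≢⇒< (s≤s⁻¹ x<1+m) (m≢x ∘ sym)) (bnd , m∉S)

last-is-max : ∀ B m → Increasing B → All (_< suc m) B → m ∈ B → ∃ λ B′ → B ≡ B′ ++ m ∷ []
last-is-max (x ∷ [])    m _         _              (here refl) = [] , refl
last-is-max (x ∷ y ∷ B) m (x<y ∷ _) (_ ∷ y≤m ∷ _)  (here refl) = ⊥-elim (<⇒≱ x<y (s≤s⁻¹ y≤m))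
last-is-max (x ∷ y ∷ B) m (_ ∷ inc) (_ ∷ bnd)      (there m∈) with last-is-max (y ∷ B) m inc bnd m∈
... | B′ , eq = x ∷ B′ , cong (x ∷_) eq

removal : ∀ m Π → All NonEmptyBlock Π → All Increasing Π → Linked FirstLt Π → All (_< suc m) (concat Π) →
  Unique (concat Π) → ¬ Has321 (concat Π) → m ∈ concat Π → ∃ λ Π₀ → Extends m Π₀ Π × All NonEmptyBlock Π₀
removal m (B ∷ Ds) (nB ∷ ne) (incB ∷ inc) ord bnd uniq free m∈ with ∈-++⁻ B m∈
... | inj₂ m∈Ds with removal m Ds ne inc (Linked.tail ord) (All.++⁻ʳ B bnd) (unique-suffix B uniq)
                      (¬Has321-suffix B free) m∈Ds
...   | Π₀ , e , ne₀ = B ∷ Π₀ , later e , nB ∷ ne₀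
removal m (B ∷ Ds) (nB ∷ ne) (incB ∷ inc) ord bnd uniq free m∈ | inj₁ m∈B
  with last-is-max B m incB (All.++⁻ˡ B bnd) m∈B
removal m (_ ∷ [])               _        _ _       _   _    _    _ | inj₁ _ | [] , refl = [] , newBlock , []
removal m (_ ∷ [] ∷ _)           (_ ∷ () ∷ _) _ _   _   _    _    _ | inj₁ _ | [] , refl
removal m (_ ∷ (d ∷ _) ∷ _)      _        _ (m<d ∷ _) (_ ∷ d≤m ∷ _) _ _ _ | inj₁ _ | [] , refl =
  ⊥-elim (<⇒≱ m<d (s≤s⁻¹ d≤m))
removal m (_ ∷ Ds) (_ ∷ ne) _ _ bnd uniq free _ | inj₁ _ | y ∷ Y , refl =
  (y ∷ Y) ∷ Ds , append incDs , tt ∷ ne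
  where
  uniq′ : Unique ((y ∷ Y) ++ m ∷ concat Ds)
  uniq′ = subst Unique (++-assoc (y ∷ Y) (m ∷ []) (concat Ds)) uniq
  incDs : Increasing (concat Ds)
  incDs = increasing-after (y ∷ Y) m (concat Ds)
    (below-max (y ∷ Y) uniq′ (All.++⁻ʳ ((y ∷ Y) ++ m ∷ []) bnd))
    (unique-suffix ((y ∷ Y) ++ m ∷ []) uniq)
    (subst (¬_ ∘ Has321) (++-assoc (y ∷ Y) (m ∷ []) (concat Ds)) free)

extends-injective : ∀ {m Π Π′ C C′} → Extends m Π C → Extends m Π′ C′ → C ≡ C′ →
  m ∉ concat Π → m ∉ concat Π′ → All NonEmptyBlock Π → All NonEmptyBlock Π′ → Π ≡ Π′
extends-injective newBlock newBlock _ _ _ _ _ = refl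
extends-injective newBlock (append {[]} _) _ _ _ _ (() ∷ _)
extends-injective {m} newBlock (append {y ∷ Y} _) eq _ _ _ _
  with () ← ++-conicalʳ Y (m ∷ []) (sym (proj₂ (∷-injective (proj₁ (∷-injective eq)))))
extends-injective {m} newBlock (later e′) eq _ m∉′ _ _ =
  ⊥-elim (m∉′ (∈-++⁺ˡ (subst (m ∈_) (proj₁ (∷-injective eq)) (here refl))))
extends-injective (append {[]} _) newBlock _ _ _ (() ∷ _) _
extends-injective {m} (append {y ∷ Y} _) newBlock eq _ _ _ _
  with () ← ++-conicalʳ Y (m ∷ []) (proj₂ (∷-injective (proj₁ (∷-injective eq))))
extends-injective (append {B} _) (append {B′} _) eq _ _ _ _ with ∷-injective eq
... | eqB , refl = cong (_∷ _) (++-cancelʳ _ B B′ eqB)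
extends-injective {m} (append {B} _) (later e′) eq _ m∉′ _ _ =
  ⊥-elim (m∉′ (∈-++⁺ˡ (subst (m ∈_) (proj₁ (∷-injective eq)) (∈-++⁺ʳ B (here refl)))))
extends-injective {m} (later e) newBlock eq m∉ _ _ _ =
  ⊥-elim (m∉ (∈-++⁺ˡ (subst (m ∈_) (sym (proj₁ (∷-injective eq))) (here refl))))
extends-injective {m} (later e) (append {B′} _) eq m∉ _ _ _ =
  ⊥-elim (m∉ (∈-++⁺ˡ (subst (m ∈_) (sym (proj₁ (∷-injective eq))) (∈-++⁺ʳ B′ (here refl)))))
extends-injective (later {B} e) (later e′) eq m∉ m∉′ (_ ∷ ne) (_ ∷ ne′) with ∷-injective eq
... | refl , eqC = cong (B ∷_) (extends-injective e e′ eqC (m∉ ∘ ∈-++⁺ʳ B) (m∉′ ∘ ∈-++⁺ʳ B) ne ne′)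

unique-concatMap : ∀ {A B : Set} (f : A → List B) {xs} → Unique xs → (∀ {x} → x ∈ xs → Unique (f x)) →
  (∀ {x y z} → x ∈ xs → y ∈ xs → z ∈ f x → z ∈ f y → x ≡ y) → Unique (concatMap f xs)
unique-concatMap f {[]}     []         _     _        = []
unique-concatMap f {x ∷ xs} (x∉ ∷ uniq) uniqF disjoint =
  Unique.++⁺ (uniqF (here refl)) (unique-concatMap f uniq (uniqF ∘ there) (λ x∈ y∈ → disjoint (there x∈) (there y∈)))
    separate
  where
  separate : Disjoint (f x) (concatMap f xs)
  separate (z∈fx , z∈rest) with find (∈-concatMap⁻ f z∈rest)
  ... | y , y∈ , z∈fy = All.lookup x∉ y∈ (disjoint (here refl) (there y∈) z∈fx z∈fy)

partitions321 : ℕ → List (List (List ℕ))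
partitions321 zero    = [] ∷ []
partitions321 (suc k) = concatMap (insertions (suc k)) (partitions321 k)

partitions321-sound : ∀ k {Π} → Π ∈ partitions321 k → IsStdPartition k Π × ¬ Has321 (concat Π)
partitions321-sound zero    (here refl) = ([] , [] , [] , ↭-refl) , λ { (_ , _ , _ , () , _) }
partitions321-sound (suc k) Π∈ with find (∈-concatMap⁻ (insertions (suc k)) Π∈)
... | Π₀ , Π₀∈ , Π∈ins = extends-std (insertions-sound (suc k) Π₀ Π∈ins) std free
  where
  std = proj₁ (partitions321-sound k Π₀∈)
  free = proj₂ (partitions321-sound k Π₀∈)

partitions321-complete : ∀ k {Π} → IsStdPartition k Π → ¬ Has321 (concat Π) → Π ∈ partitions321 k
partitions321-complete zero    {[]}          _                   _ = here refl
partitions321-complete zero    {[] ∷ _}      (() ∷ _ , _)        _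
partitions321-complete zero    {(_ ∷ _) ∷ _} (_ , _ , _ , p)     _ with () ← Perm.↭-empty-inv p
partitions321-complete (suc k) {Π} std@(ne , inc , ord , p) free
  with removal (suc k) Π ne inc ord (std-bound std) (std-unique std) free (Perm.∈-resp-↭ (↭-sym p) (max∈range k))
... | Π₀ , e , ne₀ with restricts-std e ne₀ std free
...   | std₀ , free₀ = ∈-concatMap⁺ (insertions (suc k)) (lose (partitions321-complete k std₀ free₀) (insertions-complete e))

partitions321-unique : ∀ k → Unique (partitions321 k)
partitions321-unique zero    = [] ∷ []
partitions321-unique (suc k) =
  unique-concatMap (insertions (suc k)) (partitions321-unique k) (λ {Π} _ → insertions-unique (suc k) Π)
    (λ Π∈ Π′∈ C∈ C∈′ → extends-injective (insertions-sound _ _ C∈) (insertions-sound _ _ C∈′) refl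
       (fresh Π∈) (fresh Π′∈) (nonEmpty Π∈) (nonEmpty Π′∈))
  where
  fresh : ∀ {Π} → Π ∈ partitions321 k → suc k ∉ concat Π
  fresh Π∈ k+1∈ = <-irrefl refl (All.lookup (std-bound (proj₁ (partitions321-sound k Π∈))) k+1∈)
  nonEmpty : ∀ {Π} → Π ∈ partitions321 k → All NonEmptyBlock Π
  nonEmpty Π∈ = proj₁ (proj₁ (partitions321-sound k Π∈))

does-cong : ∀ {A B : Set} (a? : Dec A) (b? : Dec B) → (A → B) → (B → A) → does a? ≡ does b?
does-cong (yes a)  b? to from = sym (dec-true b? (to a))
does-cong (no ¬a)  b? to from = sym (dec-false b? (¬a ∘ from))

increasing-suffix : ∀ X {Y} → Increasing (X ++ Y) → Increasing Y
increasing-suffix []      inc = inc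
increasing-suffix (x ∷ X) inc = increasing-suffix X (Linked.tail inc)

isIncreasing-snoc : ∀ xs m → All (_< m) xs → isIncreasing (xs ++ m ∷ []) ≡ isIncreasing xs
isIncreasing-snoc xs m bnd =
  does-cong (increasing? _) (increasing? xs) (increasing-prefix xs) (λ inc → increasing-snoc xs m inc bnd)

isIncreasing-descent : ∀ X {m s} Y → s < m → isIncreasing (X ++ m ∷ s ∷ Y) ≡ false
isIncreasing-descent X Y s<m = dec-false (increasing? _) (λ inc → <-asym s<m (Linked.head (increasing-suffix X inc)))

-- A prefix-extended list increases only if its suffix does.
isIncreasing-absorb : ∀ X Y → isIncreasing (X ++ Y) ≡ isIncreasing (X ++ Y) ∧ isIncreasing Y
isIncreasing-absorb X Y =
  does-cong (increasing? (X ++ Y)) (increasing? (X ++ Y) ×-dec increasing? Y) (λ inc → inc , increasing-suffix X inc) proj₁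

isIncreasing-extends : ∀ {m Ds C} B → Extends m Ds C → All (_< m) (B ++ concat Ds) →
  isIncreasing (B ++ concat C) ≡ isIncreasing (B ++ concat Ds) ∧ isIncreasing (concat C)
isIncreasing-extends {m} B e bnd with extends-shape e
... | A , S , eqC , eqΠ , _ rewrite eqC | eqΠ = case S bnd
  where
  case : ∀ S → All (_< m) (B ++ A ++ S) →
    isIncreasing (B ++ A ++ m ∷ S) ≡ isIncreasing (B ++ A ++ S) ∧ isIncreasing (A ++ m ∷ S)
  case [] bnd = begin
    isIncreasing (B ++ A ++ m ∷ [])              ≡⟨ cong isIncreasing (++-assoc B A (m ∷ [])) ⟨
    isIncreasing ((B ++ A) ++ m ∷ [])            ≡⟨ isIncreasing-snoc (B ++ A) m BA<m ⟩
    isIncreasing (B ++ A)                        ≡⟨ isIncreasing-absorb B A ⟩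
    isIncreasing (B ++ A) ∧ isIncreasing A       ≡⟨ cong₂ _∧_ (cong (isIncreasing ∘ (B ++_)) (++-identityʳ A))
                                                             (isIncreasing-snoc A m (All.++⁻ʳ B BA<m)) ⟨
    isIncreasing (B ++ A ++ []) ∧ isIncreasing (A ++ m ∷ []) ∎
    where
    BA<m : All (_< m) (B ++ A)
    BA<m = subst (All (_< m)) (cong (B ++_) (++-identityʳ A)) bnd
  case (s ∷ S) bnd = begin
    isIncreasing (B ++ A ++ m ∷ s ∷ S)                                ≡⟨ cong isIncreasing (++-assoc B A _) ⟨
    isIncreasing ((B ++ A) ++ m ∷ s ∷ S)                              ≡⟨ isIncreasing-descent (B ++ A) S s<m ⟩
    false                                                             ≡⟨ ∧-zeroʳ _ ⟨
    isIncreasing (B ++ A ++ s ∷ S) ∧ false                            ≡⟨ cong (_ ∧_) (isIncreasing-descent A S s<m) ⟨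
    isIncreasing (B ++ A ++ s ∷ S) ∧ isIncreasing (A ++ m ∷ s ∷ S)    ∎
    where
    s<m : s < m
    s<m = All.head (All.++⁻ʳ A (All.++⁻ʳ B bnd))

bit : Bool → ℕ
bit true  = 1
bit false = 0

-- The number of blocks after which the remaining blocks flatten to an
-- increasing list: the blocks that the next maximum may be appended to.
activeBlocks : List (List ℕ) → ℕ
activeBlocks []       = 0
activeBlocks (B ∷ Cs) = bit (isIncreasing (concat Cs)) + activeBlocks Cs

activeBlocks-pos : ∀ D Es → 1 ≤ activeBlocks (D ∷ Es)
activeBlocks-pos D []       = s≤s z≤n
activeBlocks-pos D (E ∷ Fs) = ≤-trans (activeBlocks-pos E Fs) (m≤n+m _ (bit (isIncreasing (concat (E ∷ Fs)))))

Profile : Set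
Profile = Bool × ℕ

profile : List (List ℕ) → Profile
profile C = isIncreasing (concat C) , activeBlocks C

-- The profile of B ∷ C in terms of that of C, where g says whether B followed
-- by the old blocks was increasing.
prepend : Bool → Profile → Profile
prepend g (b , l) = g ∧ b , bit b + l

profiles-later : ∀ m B Ds → All (_< m) (B ++ concat Ds) →
  map profile (map (B ∷_) (insertions m Ds)) ≡ map (prepend (isIncreasing (B ++ concat Ds))) (map profile (insertions m Ds))
profiles-later m B Ds bnd = begin
  map profile (map (B ∷_) V)          ≡⟨ map-∘ V ⟨
  map (profile ∘ (B ∷_)) V            ≡⟨ map-cong-local (All.tabulate (λ C∈ → cong (_, _)
                                           (isIncreasing-extends B (insertions-sound m Ds C∈) bnd))) ⟩
  map (prepend g ∘ profile) V         ≡⟨ map-∘ V ⟩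
  map (prepend g) (map profile V)     ∎
  where
  V = insertions m Ds
  g = isIncreasing (B ++ concat Ds)

childProfiles : ℕ → Bool → List Profile
childProfiles L g = map (false ,_) (descendTo2 L) ++ (g , L) ∷ (g , suc L) ∷ []

prepend-childProfiles : ∀ g L b → map (prepend g) (childProfiles L b) ≡
  map (false ,_) (descendTo2 L) ++ (g ∧ b , bit b + L) ∷ (g ∧ b , bit b + suc L) ∷ []
prepend-childProfiles g L b = begin
  map (prepend g) (map (false ,_) D ++ T)          ≡⟨ map-++ (prepend g) (map (false ,_) D) T ⟩
  map (prepend g) (map (false ,_) D) ++ T′         ≡⟨ cong (_++ T′) (map-∘ D) ⟨
  map (prepend g ∘ (false ,_)) D ++ T′             ≡⟨ cong (_++ T′) (map-cong (λ k → cong (_, k) (∧-zeroʳ g)) D) ⟩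
  map (false ,_) D ++ T′                           ∎
  where
  D = descendTo2 L
  T = (b , L) ∷ (b , suc L) ∷ []
  T′ = map (prepend g) T

descendTo2-suc : ∀ L → 1 ≤ L → descendTo2 (suc L) ≡ suc L ∷ descendTo2 L
descendTo2-suc (suc L) _ = refl

profiles : ∀ m B Ds → All NonEmptyBlock Ds → All (_< m) (B ++ concat Ds) →
  map profile (insertions m (B ∷ Ds)) ≡ childProfiles (activeBlocks (B ∷ Ds)) (isIncreasing (B ++ concat Ds))
profiles m B [] _ bnd = cong₂ (λ u v → (u , 1) ∷ (v , 2) ∷ []) (trans (cong isIncreasing (++-identityʳ (B ++ m ∷ []))) snoc) snoc
  where
  snoc : isIncreasing (B ++ m ∷ []) ≡ isIncreasing (B ++ [])
  snoc = trans (isIncreasing-snoc B m (subst (All (_< m)) (++-identityʳ B) bnd)) (cong isIncreasing (sym (++-identityʳ B)))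
profiles m B ([] ∷ Es) (() ∷ _) bnd
profiles m B Ds@((d ∷ D) ∷ Es) (_ ∷ ne) bnd = begin
  map profile (onlyIf b X ++ map (B ∷_) V)
    ≡⟨ map-++ profile (onlyIf b X) _ ⟩
  map profile (onlyIf b X) ++ map profile (map (B ∷_) V)
    ≡⟨ cong (map profile (onlyIf b X) ++_) (begin
         map profile (map (B ∷_) V)                ≡⟨ profiles-later m B Ds bnd ⟩
         map (prepend g) (map profile V)           ≡⟨ cong (map (prepend g)) (profiles m (d ∷ D) Es ne (All.++⁻ʳ B bnd)) ⟩
         map (prepend g) (childProfiles L b)       ≡⟨ prepend-childProfiles g L b ⟩
         _                                         ∎) ⟩
  map profile (onlyIf b X) ++ (map (false ,_) (descendTo2 L) ++ (g ∧ b , bit b + L) ∷ (g ∧ b , bit b + suc L) ∷ [])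
    ≡⟨ first b refl ⟩
  childProfiles (bit b + L) g ∎
  where
  X = (B ++ m ∷ []) ∷ Ds
  V = insertions m Ds
  b = isIncreasing (concat Ds)
  g = isIncreasing (B ++ concat Ds)
  L = activeBlocks Ds
  -- Appending m to B is only allowed when b holds, and then gives profile (false, L + 1).
  first : ∀ b′ → b ≡ b′ →
    map profile (onlyIf b′ X) ++ (map (false ,_) (descendTo2 L) ++ (g ∧ b′ , bit b′ + L) ∷ (g ∧ b′ , bit b′ + suc L) ∷ [])
    ≡ childProfiles (bit b′ + L) g
  first true  b≡true = begin
    profile X ∷ (map (false ,_) (descendTo2 L) ++ (g ∧ true , suc L) ∷ (g ∧ true , suc (suc L)) ∷ [])
      ≡⟨ cong₂ (λ u v → u ∷ (map (false ,_) (descendTo2 L) ++ (v , suc L) ∷ (v , suc (suc L)) ∷ [])) profileX (∧-identityʳ g) ⟩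
    map (false ,_) (suc L ∷ descendTo2 L) ++ (g , suc L) ∷ (g , suc (suc L)) ∷ []
      ≡⟨ cong (λ z → map (false ,_) z ++ (g , suc L) ∷ (g , suc (suc L)) ∷ []) (descendTo2-suc L (activeBlocks-pos (d ∷ D) Es)) ⟨
    childProfiles (suc L) g ∎
    where
    profileX : profile X ≡ (false , suc L)
    profileX = cong₂ _,_
      (trans (cong isIncreasing (++-assoc B (m ∷ []) (concat Ds))) (isIncreasing-descent B (D ++ concat Es) (All.head (All.++⁻ʳ B bnd))))
      (cong (λ z → bit z + L) b≡true)
  first false b≡false = cong (λ v → map (false ,_) (descendTo2 L) ++ (v , L) ∷ (v , suc L) ∷ []) (begin
    g ∧ false   ≡⟨ cong (g ∧_) b≡false ⟨
    g ∧ b       ≡⟨ isIncreasing-absorb B (concat Ds) ⟨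
    g           ∎)

activeBlocks-children : ∀ m B Ds → All NonEmptyBlock Ds → All (_< m) (B ++ concat Ds) →
  map activeBlocks (insertions m (B ∷ Ds)) ≡ flattenRule (activeBlocks (B ∷ Ds))
activeBlocks-children m B Ds ne bnd = begin
  map activeBlocks (insertions m (B ∷ Ds))          ≡⟨ map-∘ (insertions m (B ∷ Ds)) ⟩
  map proj₂ (map profile (insertions m (B ∷ Ds)))   ≡⟨ cong (map proj₂) (profiles m B Ds ne bnd) ⟩
  map proj₂ (childProfiles L g)                     ≡⟨ map-++ proj₂ (map (false ,_) (descendTo2 L)) ((g , L) ∷ (g , suc L) ∷ []) ⟩
  map proj₂ (map (false ,_) (descendTo2 L)) ++ L ∷ suc L ∷ []  ≡⟨ cong (_++ L ∷ suc L ∷ []) (trans (sym (map-∘ (descendTo2 L))) (map-id (descendTo2 L))) ⟩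
  flattenRule L                                     ∎
  where
  L = activeBlocks (B ∷ Ds)
  g = isIncreasing (B ++ concat Ds)

partitions321-rule : ∀ k {Π} → Π ∈ partitions321 (suc k) →
  map activeBlocks (insertions (suc (suc k)) Π) ≡ flattenRule (activeBlocks Π)
partitions321-rule k {Π} Π∈ with partitions321-sound (suc k) Π∈
partitions321-rule k {[]}     _ | (_ , _ , _ , p) , _ with () ← Perm.↭-empty-inv (↭-sym p)
partitions321-rule k {B ∷ Ds} _ | std@(_ ∷ ne , _) , _ = activeBlocks-children (suc (suc k)) B Ds ne (std-bound std)

weight-partitions321 : ∀ k d → weight activeBlocks flattenRule d (partitions321 (suc k)) ≡ leaves flattenRule 1 (k + d)
weight-partitions321 zero    d = +-identityʳ (leaves flattenRule 1 d)
weight-partitions321 (suc k) d = begin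
  weight activeBlocks flattenRule d (partitions321 (suc (suc k)))
    ≡⟨ weight-children activeBlocks flattenRule (insertions (suc (suc k))) d _ (partitions321-rule k) ⟩
  weight activeBlocks flattenRule (suc d) (partitions321 (suc k))
    ≡⟨ weight-partitions321 k (suc d) ⟩
  leaves flattenRule 1 (k + suc d)
    ≡⟨ cong (leaves flattenRule 1) (+-suc k d) ⟩
  leaves flattenRule 1 (suc k + d) ∎

length-partitions321 : ∀ n → length (partitions321 (suc n)) ≡ binomCatalanSum n
length-partitions321 n = begin
  length (partitions321 (suc n))                       ≡⟨ weight-zero activeBlocks flattenRule (partitions321 (suc n)) ⟨
  weight activeBlocks flattenRule 0 (partitions321 (suc n)) ≡⟨ weight-partitions321 n 0 ⟩
  leaves flattenRule 1 (n + 0)                         ≡⟨ cong (leaves flattenRule 1) (+-identityʳ n) ⟩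
  leaves flattenRule 1 n                               ≡⟨ leaves-flattenRule n ⟩
  binomCatalanSum n                                    ∎

mainTheorem6 : (n : ℕ) →
    ∃ λ (L : List (List (List ℕ))) →
      Unique L
      × ((Π : List (List ℕ)) → (Π ∈ L) ⇔ (IsStdPartition (suc n) Π × Avoids321 (Flatten Π)))
      × length L ≡ binomCatalanSum n
mainTheorem6 n =
  partitions321 (suc n) ,
  partitions321-unique (suc n) ,
  (λ Π → mk⇔ (λ Π∈ → let std , free = partitions321-sound (suc n) Π∈ in std , ¬Has321⇒avoids (concat Π) free)
             (λ (std , avoids) → partitions321-complete (suc n) std (avoids⇒¬Has321 (concat Π) avoids))) ,
  length-partitions321 n
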